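{- If $k_1,k_2\in\{1,2,\dots,\frac{\ell mn}{L}\}$ and $s_{k_1}=s_{k_2}$, then $k_1=k_2$.
   Context: Let $\ell,m,n\geq 2$ be integers, $L=\mathrm{lcm}(\ell,m,n)$ and $\lambda=\frac{n\cdot\mathrm{lcm}(\ell,m)}{L}$. Write $V(K_\ell)=\{u_1,\dots,u_\ell\}$, $V(K_m)=\{v_1,\dots,v_m\}$, $V(K_n)=\{w_1,\dots,w_n\}$, so vertices of $K_\ell\square K_m\square K_n$ are triples $(u_a,v_b,w_c)$. Let $\rho=(u_1\,u_2\,\cdots\,u_\ell)$, $\sigma=(v_1\,v_2\,\cdots\,v_m)$, $\tau=(w_1\,w_2\,\cdots\,w_n)$ be the cyclic permutations of the respective vertex sets. Define $L\times 3$ matrices $A^{(k)}=[\mathbf{c}^{(k)}\ \mathbf{d}^{(k)}\ \mathbf{e}^{(k)}]$ (columns) for $k=1,\dots,\frac{\ell mn}{L}$ as follows: row $r$ ($r=1,\dots,L$) of $A^{(1)}$ is $(\rho^{r-1}(u_1),\sigma^{r-1}(v_1),\tau^{r-1}(w_1))$; for $k>1$, $\mathbf{c}^{(k)}=\mathbf{c}^{(1)}$, and if $k\equiv 1\pmod{\lambda}$ then $\mathbf{d}^{(k)}=\sigma(\mathbf{d}^{(k-1)})$, $\mathbf{e}^{(k)}=\mathbf{e}^{(k-1)}$, while otherwise $\mathbf{d}^{(k)}=\mathbf{d}^{(k-1)}$, $\mathbf{e}^{(k)}=\tau(\mathbf{e}^{(k-1)})$ (permutations applied entrywise). Each row is regarded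 as a vertex of $K_\ell\square K_m\square K_n$. The seed $s_k$ is the first row of $A^{(k)}$. -}

module Defs where

open import Data.Nat using (ℕ; zero; suc; _+_; _*_; _∸_; _≤_; _<_; NonZero; >-nonZero; ≢-nonZero; >-nonZero⁻¹)
open import Data.Nat.Properties using (≤-trans; m*n≢0; n≤1+n)
open import Data.Nat.DivMod using (_/_; _%_; m%n<n)
open import Data.Nat.Divisibility using (_∣_; _∣?_; 0∣⇒≡0; m∣m*n; n∣m*n)
open import Data.Nat.LCM using (lcm; lcm-least; m∣lcm[m,n]; n∣lcm[m,n])
open import Data.Fin using (Fin; toℕ; fromℕ<)
open import Data.Product using (_×_; _,_)
open import Relation.Nullary using (yes; no)
open import Relation.Binary.PropositionalEquality using (_≡_; _≢_; subst)
open import Function using (_∘_)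

-- Cyclic shift i ↦ i+1 (mod k) on the vertex set Fin k of K_k.
-- Vertex x_a (a = 1..k) is represented by the index a-1 : Fin k.
cyc : ∀ {k} .{{_ : NonZero k}} → Fin k → Fin k
cyc {k} i = fromℕ< (m%n<n (suc (toℕ i)) k)

iter : ∀ {A : Set} → ℕ → (A → A) → A → A
iter zero    f x = x
iter (suc j) f x = f (iter j f x)

lcm≢0 : ∀ a b .{{_ : NonZero a}} .{{_ : NonZero b}} → lcm a b ≢ 0
lcm≢0 a b eq with m*n≢0 a b
... | nz = nzab (0∣⇒≡0 (subst (_∣ (a * b)) eq (lcm-least {a} {b} (m∣m*n b) (n∣m*n a))))
  where
  open import Data.Nat.Base using (≢-nonZero⁻¹)
  nzab : a * b ≢ 0
  nzab = ≢-nonZero⁻¹ (a * b) {{nz}}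

module Construction (ℓ m n : ℕ) (hℓ : 2 ≤ ℓ) (hm : 2 ≤ m) (hn : 2 ≤ n) where

  instance
    nzℓ : NonZero ℓ
    nzℓ = >-nonZero (≤-trans (n≤1+n 1) hℓ)
    nzm : NonZero m
    nzm = >-nonZero (≤-trans (n≤1+n 1) hm)
    nzn : NonZero n
    nzn = >-nonZero (≤-trans (n≤1+n 1) hn)

  L : ℕ
  L = lcm (lcm ℓ m) n

  instance
    nzlm : NonZero (lcm ℓ m)
    nzlm = ≢-nonZero (lcm≢0 ℓ m)
    nzL : NonZero L
    nzL = ≢-nonZero (lcm≢0 (lcm ℓ m) n)

  lam : ℕ
  lam = (n * lcm ℓ m) / L

  numMat : ℕ
  numMat = (ℓ * m * n) / L

  Vertex : Set
  Vertex = Fin ℓ × Fin m × Fin n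

  ρ : Fin ℓ → Fin ℓ
  ρ = cyc
  σ : Fin m → Fin m
  σ = cyc
  τ : Fin n → Fin n
  τ = cyc

  u₁ : Fin ℓ
  u₁ = fromℕ< (>-nonZero⁻¹ ℓ)
  v₁ : Fin m
  v₁ = fromℕ< (>-nonZero⁻¹ m)
  w₁ : Fin n
  w₁ = fromℕ< (>-nonZero⁻¹ n)

  -- An L × 3 matrix, given by its three columns (row index r-1 : Fin L).
  record Matrix : Set where
    constructor mat
    field
      c : Fin L → Fin ℓ
      d : Fin L → Fin m
      e : Fin L → Fin n

  row : Matrix → Fin L → Vertex
  row M i = Matrix.c M i , Matrix.d M i , Matrix.e M i

  A₁ : Matrix
  A₁ = mat (λ i → iter (toℕ i) ρ u₁) (λ i → iter (toℕ i) σ v₁) (λ i → iter (toℕ i) τ w₁)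

  -- A k = A^(k) for k ≥ 1 (A 0 is an unused junk value).
  step : ℕ → Matrix → Matrix
  step k M with lam ∣? (k ∸ 1)
  ... | yes _ = mat (Matrix.c M) (σ ∘ Matrix.d M) (Matrix.e M)
  ... | no  _ = mat (Matrix.c M) (Matrix.d M) (τ ∘ Matrix.e M)

  A : ℕ → Matrix
  A zero = A₁
  A (suc zero) = A₁
  A (suc (suc j)) = step (suc (suc j)) (A (suc j))

  r₁ : Fin L
  r₁ = fromℕ< (>-nonZero⁻¹ L)

  seed : ℕ → Vertex
  seed k = row (A k) r₁

-- Write k - 1 = qλ + r with r < λ.  Of the k - 1 steps producing A^(k), exactly q apply σ
-- (those at multiples of λ) and the others apply τ, so the seed s_k is
-- (u₁, σ^q v₁, τ^(r + q(λ-1)) w₁).  Since L ∣ n·lcm(ℓ,m) we have λ ≤ n and ℓmn/L ≤ mλ,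
-- hence q < m is read off the second coordinate, and then r < λ ≤ n off the third.
module Submission where

open import Defs
open import Data.Nat using (ℕ; _≤_; zero; suc; pred; _+_; _*_; _∸_; _<_; NonZero; >-nonZero; >-nonZero⁻¹)
open import Data.Nat.Properties
open import Data.Nat.DivMod
open import Data.Nat.Divisibility
open import Data.Nat.LCM using (lcm; lcm-least; m∣lcm[m,n])
open import Data.Nat.Tactic.RingSolver using (solve-∀)
open import Data.Fin using (Fin; toℕ)
open import Data.Fin.Properties using (toℕ-fromℕ<; toℕ<n)
open import Data.Product using (_×_; _,_; proj₁; proj₂; map₁; map₂)
open import Function using (_∘_)
open import Relation.Nullary using (yes; no; ¬_; contradiction)
open import Relation.Binary.PropositionalEquality using (_≡_; refl; sym; trans; cong; cong₂; subst; module ≡-Reasoning)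

iter-+ : ∀ {A : Set} a b (f : A → A) x → iter (a + b) f x ≡ iter a f (iter b f x)
iter-+ zero    b f x = refl
iter-+ (suc a) b f x = cong f (iter-+ a b f x)

[1+m%n]%n≡[1+m]%n : ∀ m n .{{_ : NonZero n}} → suc (m % n) % n ≡ suc m % n
[1+m%n]%n≡[1+m]%n m n = begin
  (1 + m % n) % n          ≡⟨ %-distribˡ-+ 1 (m % n) n ⟩
  (1 % n + m % n % n) % n  ≡⟨ cong (λ t → (1 % n + t) % n) (m%n%n≡m%n m n) ⟩
  (1 % n + m % n) % n      ≡⟨ %-distribˡ-+ 1 m n ⟨
  (1 + m) % n              ∎
  where open ≡-Reasoning

toℕ-iter-cyc : ∀ {k} .{{_ : NonZero k}} j (i : Fin k) → toℕ (iter j cyc i) ≡ (toℕ i + j) % k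
toℕ-iter-cyc {k} zero i = sym (trans (cong (_% k) (+-identityʳ (toℕ i))) (m<n⇒m%n≡m (toℕ<n i)))
toℕ-iter-cyc {k} (suc j) i = begin
  toℕ (cyc (iter j cyc i))        ≡⟨ toℕ-fromℕ< _ ⟩
  suc (toℕ (iter j cyc i)) % k    ≡⟨ cong (λ t → suc t % k) (toℕ-iter-cyc j i) ⟩
  suc ((toℕ i + j) % k) % k       ≡⟨ [1+m%n]%n≡[1+m]%n (toℕ i + j) k ⟩
  suc (toℕ i + j) % k             ≡⟨ cong (_% k) (+-suc (toℕ i) j) ⟨
  (toℕ i + suc j) % k             ∎
  where open ≡-Reasoning

%≡%⇒∣∸ : ∀ x y n .{{_ : NonZero n}} → x % n ≡ y % n → n ∣ y ∸ x
%≡%⇒∣∸ x y n eq = divides (y / n ∸ x / n) (begin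
  y ∸ x                                          ≡⟨ cong₂ _∸_ (m≡m%n+[m/n]*n y n) (m≡m%n+[m/n]*n x n) ⟩
  (y % n + y / n * n) ∸ (x % n + x / n * n)      ≡⟨ cong (λ t → (t + y / n * n) ∸ (x % n + x / n * n)) eq ⟨
  (x % n + y / n * n) ∸ (x % n + x / n * n)      ≡⟨ [m+n]∸[m+o]≡n∸o (x % n) _ _ ⟩
  y / n * n ∸ x / n * n                          ≡⟨ *-distribʳ-∸ n (y / n) (x / n) ⟨
  (y / n ∸ x / n) * n                            ∎)
  where open ≡-Reasoning

+-cancelˡ-% : ∀ t {a b n} .{{_ : NonZero n}} → a < n → b < n → (t + a) % n ≡ (t + b) % n → a ≡ b
+-cancelˡ-% t a<n b<n eq = ≤-antisym (≤-from a<n (sym eq)) (≤-from b<n eq)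
  where
  ≤-from : ∀ {a b n} .{{_ : NonZero n}} → b < n → (t + a) % n ≡ (t + b) % n → b ≤ a
  ≤-from {a} {b} {n} b<n eq = m∸n≡0⇒m≤n (begin
    b ∸ a          ≡⟨ m<n⇒m%n≡m (≤-<-trans (m∸n≤m b a) b<n) ⟨
    (b ∸ a) % n    ≡⟨ n∣m⇒m%n≡0 (b ∸ a) n (subst (n ∣_) ([m+n]∸[m+o]≡n∸o t b a) (%≡%⇒∣∸ _ _ n eq)) ⟩
    0              ∎)
    where open ≡-Reasoning

iter-cyc-injective : ∀ {k} .{{_ : NonZero k}} (i : Fin k) {a b} → a < k → b < k →
                     iter a cyc i ≡ iter b cyc i → a ≡ b
iter-cyc-injective i {a} {b} a<k b<k eq =
  +-cancelˡ-% (toℕ i) a<k b<k (trans (sym (toℕ-iter-cyc a i)) (trans (cong toℕ eq) (toℕ-iter-cyc b i)))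

module Seeds (ℓ m n : ℕ) (hℓ : 2 ≤ ℓ) (hm : 2 ≤ m) (hn : 2 ≤ n) where
  open Construction ℓ m n hℓ hm hn

  L∣n*lcm : L ∣ n * lcm ℓ m
  L∣n*lcm = lcm-least (n∣m*n n) (m∣m*n (lcm ℓ m))

  instance
    lam-nonZero : NonZero lam
    lam-nonZero = >-nonZero (m≥n⇒m/n>0 (∣⇒≤ {{m*n≢0 n (lcm ℓ m)}} L∣n*lcm))

  lam≤n : lam ≤ n
  lam≤n = ≤-trans (/-monoˡ-≤ L (*-monoʳ-≤ n (∣⇒≤ (m∣lcm[m,n] (lcm ℓ m) n))))
                  (≤-reflexive (m*n/n≡m n L))

  numMat≤m*lam : numMat ≤ m * lam
  numMat≤m*lam = ≤-trans (/-monoˡ-≤ L ℓmn≤m*[n*lcm]) (≤-reflexive (*-/-assoc m L∣n*lcm))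
    where
    *-rotate : ∀ a b c → a * (b * c) ≡ c * a * b
    *-rotate = solve-∀
    ℓmn≤m*[n*lcm] : ℓ * m * n ≤ m * (n * lcm ℓ m)
    ℓmn≤m*[n*lcm] = subst (_≤ m * (n * lcm ℓ m)) (*-rotate m n ℓ)
                      (*-monoʳ-≤ m (*-monoʳ-≤ n (∣⇒≤ (m∣lcm[m,n] ℓ m))))

  seed-step-∣ : ∀ j → lam ∣ suc j → seed (suc (suc j)) ≡ map₂ (map₁ σ) (seed (suc j))
  seed-step-∣ j lam∣ with lam ∣? suc j
  ... | yes _   = refl
  ... | no lam∤ = contradiction lam∣ lam∤

  seed-step-∤ : ∀ j → ¬ lam ∣ suc j → seed (suc (suc j)) ≡ map₂ (map₂ τ) (seed (suc j))
  seed-step-∤ j lam∤ with lam ∣? suc j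
  ... | yes lam∣ = contradiction lam∣ lam∤
  ... | no _     = refl

  closedSeed : ℕ → ℕ → Vertex
  closedSeed q r = u₁ , iter q σ v₁ , iter (r + q * pred lam) τ w₁

  seed-closedSeed : ∀ q r → r < lam → seed (suc (r + q * lam)) ≡ closedSeed q r
  seed-closedSeed zero zero _ =
    cong (λ t → iter t ρ u₁ , iter t σ v₁ , iter t τ w₁) (toℕ-fromℕ< (>-nonZero⁻¹ L))
  seed-closedSeed (suc q) zero _ = begin
    seed (suc (lam + q * lam))                      ≡⟨ cong (λ i → seed (suc (i + q * lam))) (suc-pred lam) ⟨
    seed (suc (suc (pred lam + q * lam)))           ≡⟨ seed-step-∣ _ lam∣ ⟩
    map₂ (map₁ σ) (seed (suc (pred lam + q * lam)))
      ≡⟨ cong (map₂ (map₁ σ)) (seed-closedSeed q (pred lam) pred-lam<lam) ⟩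
    closedSeed (suc q) zero                         ∎
    where
    open ≡-Reasoning
    pred-lam<lam : pred lam < lam
    pred-lam<lam = ≤-reflexive (suc-pred lam)
    lam∣ : lam ∣ suc (pred lam + q * lam)
    lam∣ = subst (λ i → lam ∣ i + q * lam) (sym (suc-pred lam)) (∣m∣n⇒∣m+n ∣-refl (n∣m*n q))
  seed-closedSeed q (suc r) 1+r<lam = begin
    seed (suc (suc (r + q * lam)))           ≡⟨ seed-step-∤ _ lam∤ ⟩
    map₂ (map₂ τ) (seed (suc (r + q * lam))) ≡⟨ cong (map₂ (map₂ τ)) (seed-closedSeed q r (<⇒≤ 1+r<lam)) ⟩
    closedSeed q (suc r)                     ∎
    where
    open ≡-Reasoning
    lam∤ : ¬ lam ∣ suc r + q * lam
    lam∤ lam∣ = <⇒≱ 1+r<lam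
      (∣⇒≤ (∣m+n∣m⇒∣n (subst (lam ∣_) (+-comm (suc r) (q * lam)) lam∣) (n∣m*n q)))

  seed≡closedSeed : ∀ j → seed (suc j) ≡ closedSeed (j / lam) (j % lam)
  seed≡closedSeed j = trans (cong (seed ∘ suc) (m≡m%n+[m/n]*n j lam))
                            (seed-closedSeed (j / lam) (j % lam) (m%n<n j lam))

  closedSeed-injective : ∀ {q₁ q₂ r₁ r₂} → q₁ < m → q₂ < m → r₁ < lam → r₂ < lam →
                         closedSeed q₁ r₁ ≡ closedSeed q₂ r₂ → q₁ ≡ q₂ × r₁ ≡ r₂
  closedSeed-injective {q₁} {r₁ = r₁} {r₂} q₁<m q₂<m r₁<lam r₂<lam eq
    with refl ← iter-cyc-injective v₁ q₁<m q₂<m (cong (proj₁ ∘ proj₂) eq)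
    = refl , iter-cyc-injective (iter (q₁ * pred lam) τ w₁)
               (<-≤-trans r₁<lam lam≤n) (<-≤-trans r₂<lam lam≤n)
               (trans (sym (iter-+ r₁ _ τ w₁)) (trans (cong (proj₂ ∘ proj₂) eq) (iter-+ r₂ _ τ w₁)))

  seed-injective : ∀ {j₁ j₂} → j₁ < numMat → j₂ < numMat → seed (suc j₁) ≡ seed (suc j₂) → j₁ ≡ j₂
  seed-injective {j₁} {j₂} j₁<numMat j₂<numMat eq = begin
    j₁                        ≡⟨ m≡m%n+[m/n]*n j₁ lam ⟩
    j₁ % lam + j₁ / lam * lam ≡⟨ cong₂ (λ r q → r + q * lam) (proj₂ q₁≡q₂×r₁≡r₂) (proj₁ q₁≡q₂×r₁≡r₂) ⟩
    j₂ % lam + j₂ / lam * lam ≡⟨ m≡m%n+[m/n]*n j₂ lam ⟨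
    j₂                        ∎
    where
    open ≡-Reasoning
    quotient<m : ∀ {j} → j < numMat → j / lam < m
    quotient<m j<numMat = m<n*o⇒m/o<n (<-≤-trans j<numMat numMat≤m*lam)
    q₁≡q₂×r₁≡r₂ : j₁ / lam ≡ j₂ / lam × j₁ % lam ≡ j₂ % lam
    q₁≡q₂×r₁≡r₂ = closedSeed-injective (quotient<m j₁<numMat) (quotient<m j₂<numMat)
                    (m%n<n j₁ lam) (m%n<n j₂ lam)
                    (trans (sym (seed≡closedSeed j₁)) (trans eq (seed≡closedSeed j₂)))

mainTheorem5 : (ℓ m n : ℕ) (hℓ : 2 ≤ ℓ) (hm : 2 ≤ m) (hn : 2 ≤ n) (k₁ k₂ : ℕ) →
    1 ≤ k₁ → k₁ ≤ Construction.numMat ℓ m n hℓ hm hn →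
    1 ≤ k₂ → k₂ ≤ Construction.numMat ℓ m n hℓ hm hn →
    Construction.seed ℓ m n hℓ hm hn k₁ ≡ Construction.seed ℓ m n hℓ hm hn k₂ →
    k₁ ≡ k₂
mainTheorem5 ℓ m n hℓ hm hn (suc j₁) (suc j₂) _ 1+j₁≤numMat _ 1+j₂≤numMat eq =
  cong suc (Seeds.seed-injective ℓ m n hℓ hm hn 1+j₁≤numMat 1+j₂≤numMat eq)
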